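{- Let $G=\mathbb{Z}_2\times\mathbb{Z}_2\times\mathbb{Z}_m\times\mathbb{Z}_k$ where $m$ and $k$ are odd and relatively prime. Then in $\mathsf{GEN}(G)$ the structure class $X_G$ has type $(0,0,0)$, every semi-terminal structure class has type $(0,1,2)$, and every non-terminal structure class has type $(1,1,0)$; in particular the nim-number of $\mathsf{GEN}(G)$ is $1$.
   Context: The achievement game $\mathsf{GEN}(G)$ is the impartial game (normal play) with starting position $\emptyset$, positions $\emptyset$, the subsets $P\subseteq G$ with $\langle P\rangle\neq G$, and the subsets $P$ with $\langle P\rangle=G$ such that $\langle P\setminus\{s\}\rangle\neq G$ for some $s\in P$; a non-generating $P$ has options $\{P\cup\{g\}:g\in G\setminus P\}$ and a generating $P$ has none; $\operatorname{nim}(P)=\operatorname{mex}\{\operatorname{nim}(Q):Q\in\operatorname{Opt}(P)\}$ ($\operatorname{mex}$ = least nonnegative integer not in the set); the nim-number of the game is $\operatorname{nim}(\emptyset)$. Let $\mathcal{M}$ be the set of maximal subgroups and $\mathcal{I}=\{\bigcap\mathcal{N}:\emptyset\neq\mathcal{N}\subseteq\mathcal{M}\}$. For $I\in\mathcal{I}$, $X_I=\{P\subseteq I:\text{there is no }J\in\mathcal{I}\text{ with }J\subsetneq I\text{ and }P\subseteq J\}$; $X_G$ is the set of positions that generate $G$ (the terminal class). With $\operatorname{pty}(n)=1$ for odd $n$ and $0$ for even $n$, the type of $X_I$ is $(\operatorname{pty}(|I|),\operatorname{nim}(P),\operatorname{nim}(Q))$ for $P,Q\in X_I$ with $|P|$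 even, $|Q|$ odd; the type of $X_G$ is $(\operatorname{pty}(|G|),0,0)$. $X_I$ ($I\in\mathcal{I}$) is semi-terminal if $\langle I\cup\{g\}\rangle=G$ for some $g\in G$, and non-terminal otherwise. -}

module Defs where

open import Data.Nat using (ℕ; zero; suc; _+_; _∸_; _<_; NonZero)
open import Data.Nat.DivMod using (_mod_; _%_)
open import Data.Fin using (Fin; toℕ; _≟_)
open import Data.Bool using (Bool; true; false; _∨_; _∧_; not)
open import Data.List using (List; []; _∷_; length; filterᵇ; cartesianProduct; allFin)
open import Data.List.Relation.Unary.All using (All)
open import Data.Product using (Σ; ∃; ∃-syntax; _×_; _,_)
open import Data.Product.Properties using (≡-dec)
open import Function.Bundles using (_⇔_)
open import Relation.Nullary using (¬_; Dec)
open import Relation.Nullary.Decidable using (⌊_⌋)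
open import Relation.Binary.PropositionalEquality using (_≡_)

pty : ℕ → ℕ
pty n = n % 2

module Zn (n : ℕ) .{{_ : NonZero n}} where
  z0 : Fin n
  z0 = 0 mod n
  _⊕_ : Fin n → Fin n → Fin n
  a ⊕ b = (toℕ a + toℕ b) mod n
  ⊖_ : Fin n → Fin n
  ⊖ a = (n ∸ toℕ a) mod n

module GEN (m k : ℕ) .{{_ : NonZero m}} .{{_ : NonZero k}} where
  open Zn 2 renaming (z0 to z0₂; _⊕_ to _⊕₂_; ⊖_ to ⊖₂_)
  open Zn m renaming (z0 to z0ₘ; _⊕_ to _⊕ₘ_; ⊖_ to ⊖ₘ_)
  open Zn k renaming (z0 to z0ₖ; _⊕_ to _⊕ₖ_; ⊖_ to ⊖ₖ_)

  G : Set
  G = Fin 2 × Fin 2 × Fin m × Fin k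

  e : G
  e = z0₂ , z0₂ , z0ₘ , z0ₖ

  _·_ : G → G → G
  (a , b , c , d) · (a' , b' , c' , d') = (a ⊕₂ a') , (b ⊕₂ b') , (c ⊕ₘ c') , (d ⊕ₖ d')

  inv : G → G
  inv (a , b , c , d) = (⊖₂ a) , (⊖₂ b) , (⊖ₘ c) , (⊖ₖ d)

  _≟G_ : (x y : G) → Dec (x ≡ y)
  _≟G_ = ≡-dec _≟_ (≡-dec _≟_ (≡-dec _≟_ _≟_))

  allG : List G
  allG = cartesianProduct (allFin 2) (cartesianProduct (allFin 2) (cartesianProduct (allFin m) (allFin k)))

  Sub : Set
  Sub = G → Bool

  _∈_ : G → Sub → Set
  x ∈ P = P x ≡ true

  _⊆_ : Sub → Sub → Set
  P ⊆ Q = ∀ x → x ∈ P → x ∈ Q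

  _≐_ : Sub → Sub → Set
  P ≐ Q = P ⊆ Q × Q ⊆ P

  _⊊_ : Sub → Sub → Set
  P ⊊ Q = P ⊆ Q × ¬ (Q ⊆ P)

  ∅ : Sub
  ∅ _ = false

  full : Sub
  full _ = true

  _∪｛_｝ : Sub → G → Sub
  (P ∪｛ g ｝) x = P x ∨ ⌊ x ≟G g ⌋

  _∖｛_｝ : Sub → G → Sub
  (P ∖｛ s ｝) x = P x ∧ not ⌊ x ≟G s ⌋

  card : Sub → ℕ
  card P = length (filterᵇ P allG)

  data ⟨_⟩ (P : Sub) : G → Set where
    gen  : ∀ {x} → x ∈ P → ⟨ P ⟩ x
    unit : ⟨ P ⟩ e
    mul  : ∀ {x y} → ⟨ P ⟩ x → ⟨ P ⟩ y → ⟨ P ⟩ (x · y)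
    inverse : ∀ {x} → ⟨ P ⟩ x → ⟨ P ⟩ (inv x)

  Generates : Sub → Set
  Generates P = ∀ x → ⟨ P ⟩ x

  IsSubgroup : Sub → Set
  IsSubgroup H = (e ∈ H) × (∀ x y → x ∈ H → y ∈ H → (x · y) ∈ H) × (∀ x → x ∈ H → inv x ∈ H)

  IsMaximal : Sub → Set
  IsMaximal M = IsSubgroup M × ¬ (full ⊆ M)
              × (∀ K → IsSubgroup K → M ⊆ K → (K ⊆ M) ⊎' (full ⊆ K))
    where
    open import Data.Sum using () renaming (_⊎_ to _⊎'_)

  -- 𝓘: intersections of nonempty (necessarily finite) families of maximal subgroups
  Intersection : List Sub → Sub → Set
  Intersection Ns I = ∀ x → (x ∈ I) ⇔ All (λ M → x ∈ M) Ns

  In𝓘 : Sub → Set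
  In𝓘 I = ∃[ M ] ∃[ Ns ] (All IsMaximal (M ∷ Ns) × Intersection (M ∷ Ns) I)

  InX : Sub → Sub → Set
  InX I P = P ⊆ I × ¬ (∃[ J ] (In𝓘 J × J ⊊ I × P ⊆ J))

  SemiTerminal : Sub → Set
  SemiTerminal I = ∃[ g ] Generates (I ∪｛ g ｝)

  NonTerminal : Sub → Set
  NonTerminal I = ¬ SemiTerminal I

  IsPosition : Sub → Set
  IsPosition P = Generates P → ∃[ s ] (s ∈ P × ¬ Generates (P ∖｛ s ｝))

  IsMex : (ℕ → Set) → ℕ → Set
  IsMex S n = ¬ S n × (∀ j → j < n → S j)

  IsNim : (Sub → ℕ) → Set
  IsNim nim = ∀ P → (Generates P → nim P ≡ 0)
                  × (¬ Generates P →
                       IsMex (λ j → ∃[ g ] (P g ≡ false × nim (P ∪｛ g ｝) ≡ j)) (nim P))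

  HasType : (Sub → ℕ) → Sub → ℕ → ℕ → ℕ → Set
  HasType nim I a b c = pty (card I) ≡ a
    × (∀ P → InX I P → pty (card P) ≡ 0 → nim P ≡ b)
    × (∀ P → InX I P → pty (card P) ≡ 1 → nim P ≡ c)

  HasTypeG : (Sub → ℕ) → ℕ → ℕ → ℕ → Set
  HasTypeG nim a b c = pty (card full) ≡ a
    × (∀ P → IsPosition P → Generates P → pty (card P) ≡ 0 → nim P ≡ b)
    × (∀ P → IsPosition P → Generates P → pty (card P) ≡ 1 → nim P ≡ c)

  Conclusion : (Sub → ℕ) → Set
  Conclusion nim = HasTypeG nim 0 0 0
    × (∀ I → In𝓘 I → SemiTerminal I → HasType nim I 0 1 2)
    × (∀ I → In𝓘 I → NonTerminal I → HasType nim I 1 1 0)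
    × nim ∅ ≡ 1

-- Write G = V × C with V = ℤ₂ × ℤ₂ and C = ℤ_m × ℤ_k, a cyclic group of odd order.  If P ⊆ C, then
-- neither P nor any P ∪ {g} generates G, because the V-components of ⟨P ∪ {g}⟩ stay on the line {0, π g}.
-- If P contains some x outside C, then P ∪ {g} generates G for g with V-component completing π x to a
-- basis of V and C-component (1, 1): the (mk)-th powers recover the V-parts, and by the Chinese remainder
-- theorem even powers of g sweep out C.  Hence the nim-number of a non-generating position P depends only
-- on whether P ⊆ C and on the parity of |P|: it is 1 or 0 inside C and 1 or 2 outside C (even or odd |P|).
-- The mex recursion for these values needs two counting facts: translation by a nonzero element of V is
-- an involution without fixed points (so such translation-closed sets are even), and inversion on a
-- subset of C fixes only e (so inversion-closed sets containing e are odd).  Nim functions are unique,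
-- so every structure class can be read off: a non-terminal I lies in C and has odd order, type (1, 1, 0);
-- a semi-terminal I does not lie in C and has even order, and its positions avoid C because I ∩ C is a
-- smaller member of 𝓘, giving type (0, 1, 2); finally nim(∅) = 1.

module Submission where

open import Defs
open import Level using (0ℓ)
open import Algebra.Bundles using (AbelianGroup)
open import Algebra.Structures using (IsAbelianGroup)
import Algebra.Properties.AbelianGroup as AbelianGroupProperties
open import Data.Bool using (Bool; true; false; _∨_; _∧_)
import Data.Bool as Bool
open import Data.Bool.Properties using (T-≡; T?; ∨-zeroʳ)
open import Data.Fin using (Fin; zero; suc; toℕ)
import Data.Fin as Fin
open import Data.Fin.Properties using (toℕ-injective; toℕ-fromℕ<; toℕ<n)
open import Data.List using (List; []; _∷_; _++_; length; filter; filterᵇ)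
open import Data.List.Properties using (length-filter; filter-none; filter-accept; filter-reject; filter-all)
open import Data.List.Membership.Propositional using (find; lose) renaming (_∈_ to _∈ₗ_)
open import Data.List.Membership.Propositional.Properties using (∈-filter⁺; ∈-filter⁻)
import Data.List.Membership.Propositional.Properties as Membership
open import Data.List.Relation.Unary.All as All using (All; []; _∷_)
import Data.List.Relation.Unary.All.Properties as AllProperties
open import Data.List.Relation.Unary.Any using (here; there; any?)
open import Data.List.Relation.Unary.AllPairs using ([]; _∷_)
open import Data.List.Relation.Unary.Unique.Propositional using (Unique)
import Data.List.Relation.Unary.Unique.Propositional.Properties as Unique
open import Data.Nat using (ℕ; zero; suc; _+_; _*_; _∸_; _≤_; _<_; z≤n; s≤s; NonZero)
open import Data.Nat.Properties
  using (≤-refl; ≤-trans; ≤-<-trans; <-irrefl; <-cmp; <⇒≤; m≤n⇒m≤1+n; m≤m+n; +-suc; +-comm; +-assoc; +-identityʳ;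
         *-comm; *-assoc; *-zeroʳ; *-identityˡ; *-identityʳ; m+[n∸m]≡n; ∸-monoʳ-<)
open import Data.Nat.DivMod
  using (_%_; _mod_; %-distribˡ-+; %-distribˡ-*; m%n%n≡m%n; n%n≡0; m*n%n≡0; [m+kn]%n≡m%n; m<n⇒m%n≡m;
         %-remove-+ˡ; %-remove-+ʳ)
open import Data.Nat.Divisibility using (_∣_; divides; m∣m*n; n∣m*n; ∣m⇒∣m*n; n∣m⇒m%n≡0; m%n≡0⇒n∣m)
open import Data.Nat.Coprimality as Coprimality using (Coprime; coprime-Bézout)
open import Data.Nat.GCD using (module Bézout)
open import Data.Nat.Solver using (module +-*-Solver)
open import Data.Product using (∃; ∃-syntax; _×_; _,_; proj₁; proj₂)
open import Data.Product.Properties using (≡-dec)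
open import Data.Sum using (_⊎_; inj₁; inj₂)
open import Function using (_∘_; Equivalence; mk⇔)
open import Relation.Nullary using (¬_; Dec; yes; no; does; ¬?; contradiction; _×-dec_; _⊎-dec_)
open import Relation.Nullary.Decidable using (decidable-stable; _→-dec_; ⌊_⌋; dec-true; does-⇔)
import Relation.Nullary.Decidable as Dec
open import Relation.Unary using (Pred; Decidable)
open import Relation.Binary using (DecidableEquality)
open import Relation.Binary.Definitions using (tri<; tri≈; tri>)
open import Relation.Binary.PropositionalEquality
open import Relation.Binary.PropositionalEquality.Algebra using (isMagma)

open +-*-Solver using (solve; _:*_; _:+_; con; _:=_)

module _ {A : Set} where

  length-filterᵇ-mono : ∀ {S S′ : A → Bool} → (∀ x → S x ≡ true → S′ x ≡ true) →
                        ∀ xs → length (filterᵇ S xs) ≤ length (filterᵇ S′ xs)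
  length-filterᵇ-mono h [] = z≤n
  length-filterᵇ-mono {S} {S′} h (x ∷ xs) with S x in Sx | S′ x in S′x
  ... | true  | true  = s≤s (length-filterᵇ-mono h xs)
  ... | true  | false = contradiction (trans (sym (h x Sx)) S′x) λ ()
  ... | false | true  = m≤n⇒m≤1+n (length-filterᵇ-mono h xs)
  ... | false | false = length-filterᵇ-mono h xs

  length-filterᵇ-< : ∀ {S S′ : A → Bool} → (∀ x → S x ≡ true → S′ x ≡ true) →
                     ∀ {y xs} → y ∈ₗ xs → S′ y ≡ true → S y ≡ false →
                     length (filterᵇ S xs) < length (filterᵇ S′ xs)
  length-filterᵇ-< {S} {S′} h {xs = x ∷ xs} (here refl) S′y Sy rewrite S′y | Sy =
    s≤s (length-filterᵇ-mono h xs)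
  length-filterᵇ-< {S} {S′} h {xs = x ∷ xs} (there y∈) S′y Sy with S x in Sx | S′ x in S′x
  ... | true  | true  = s≤s (length-filterᵇ-< h y∈ S′y Sy)
  ... | true  | false = contradiction (trans (sym (h x Sx)) S′x) λ ()
  ... | false | true  = m≤n⇒m≤1+n (length-filterᵇ-< h y∈ S′y Sy)
  ... | false | false = length-filterᵇ-< h y∈ S′y Sy

bool-ext : ∀ {a b} → (a ≡ true → b ≡ true) → (b ≡ true → a ≡ true) → a ≡ b
bool-ext {true}  {true}  _ _ = refl
bool-ext {true}  {false} h _ = sym (h refl)
bool-ext {false} {true}  _ h = h refl
bool-ext {false} {false} _ _ = refl

does-true : ∀ {A : Set} (a? : Dec A) → does a? ≡ true → A
does-true (yes a) _ = a

implies? : ∀ a b → Dec (a ≡ true → b ≡ true)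
implies? a b = (a Bool.≟ true) →-dec (b Bool.≟ true)

¬implies : ∀ {a b} → ¬ (a ≡ true → b ≡ true) → a ≡ true × b ≡ false
¬implies {true}  {false} _ = refl , refl
¬implies {true}  {true}  h = contradiction (λ _ → refl) h
¬implies {false}         h = contradiction (λ ()) h

module Enumeration {A : Set} (enum : List A) (∈-enum : ∀ x → x ∈ₗ enum) where

  ∀? : ∀ {p} {P : Pred A p} → Decidable P → Dec (∀ x → P x)
  ∀? P? = Dec.map′ (λ h x → All.lookup h (∈-enum x)) (λ h → All.tabulate λ {x} _ → h x) (All.all? P? enum)

  ∃? : ∀ {p} {P : Pred A p} → Decidable P → Dec (∃ P)
  ∃? P? = Dec.map′ (λ h → let (x , _ , px) = find h in x , px) (λ (x , px) → lose (∈-enum x) px) (any? P? enum)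

  ¬∀⇒∃¬ : ∀ {p} {P : Pred A p} → Decidable P → ¬ (∀ x → P x) → ∃ λ x → ¬ P x
  ¬∀⇒∃¬ P? ¬∀P with ∃? (¬? ∘ P?)
  ... | yes ∃¬P = ∃¬P
  ... | no ¬∃¬P = contradiction (λ x → decidable-stable (P? x) (λ ¬Px → ¬∃¬P (x , ¬Px))) ¬∀P

  size : (A → Bool) → ℕ
  size S = length (filterᵇ S enum)

  -- Every step that is not yet closed adds an element, so |A| + 1 steps reach a closed predicate.
  module Iteration (f : (A → Bool) → (A → Bool))
                   (f-inflationary : ∀ S x → S x ≡ true → f S x ≡ true)
                   (f-cong : ∀ {S S′} → (∀ x → S x ≡ S′ x) → ∀ x → f S x ≡ f S′ x)
                   (seed : A → Bool) where

    iterate : ℕ → A → Bool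
    iterate zero    = seed
    iterate (suc i) = f (iterate i)

    Closed : (A → Bool) → Set
    Closed S = ∀ x → f S x ≡ true → S x ≡ true

    private
      closed? : ∀ S → Dec (Closed S)
      closed? S = ∀? λ x → implies? (f S x) (S x)

      iterate-stays : ∀ j → Closed (iterate j) → ∀ d x → iterate (d + j) x ≡ iterate j x
      iterate-stays j cl zero    x = refl
      iterate-stays j cl (suc d) x =
        trans (f-cong (iterate-stays j cl d) x) (bool-ext (cl x) (f-inflationary _ x))

      grows-or-closes : ∀ i → (∃[ j ] (j ≤ i × Closed (iterate j))) ⊎ (i ≤ size (iterate i))
      grows-or-closes zero = inj₂ z≤n
      grows-or-closes (suc i) with grows-or-closes i
      ... | inj₁ (j , j≤i , cl) = inj₁ (j , m≤n⇒m≤1+n j≤i , cl)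
      ... | inj₂ i≤size with closed? (iterate i)
      ...   | yes cl = inj₁ (i , m≤n⇒m≤1+n ≤-refl , cl)
      ...   | no ¬cl =
        let (x , ¬clx) = ¬∀⇒∃¬ (λ x → implies? (f (iterate i) x) (iterate i x)) ¬cl
            (fx , ¬Sx) = ¬implies ¬clx
        in inj₂ (≤-<-trans i≤size (length-filterᵇ-< (f-inflationary _) (∈-enum x) fx ¬Sx))

    limit : A → Bool
    limit = iterate (suc (length enum))

    limit-closed : Closed limit
    limit-closed with grows-or-closes (suc (length enum))
    ... | inj₂ n≤size = contradiction (≤-trans n≤size (length-filter _ enum)) (<-irrefl refl)
    ... | inj₁ (j , j≤n , cl) = λ x fx →
      let limit≗ : ∀ x → limit x ≡ iterate j x
          limit≗ x = subst (λ i → iterate i x ≡ iterate j x)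
                           (trans (+-comm (suc (length enum) ∸ j) j) (m+[n∸m]≡n j≤n))
                           (iterate-stays j cl (suc (length enum) ∸ j) x)
      in trans (limit≗ x) (cl x (trans (sym (f-cong limit≗ x)) fx))

module _ {A : Set} (_≟_ : DecidableEquality A) where

  private
    _≢?_ : (x : A) → Decidable (λ y → ¬ y ≡ x)
    _≢?_ x y = ¬? (y ≟ x)

  length-remove : ∀ {x xs} → Unique xs → x ∈ₗ xs → length xs ≡ suc (length (filter (x ≢?_) xs))
  length-remove {x} {xs = x ∷ ys} (x∉ys ∷ _) (here refl) =
    cong suc (cong length (sym (trans (filter-reject (x ≢?_) (λ x≢x → x≢x refl))
                                      (filter-all (x ≢?_) (All.map (λ x≢y y≡x → x≢y (sym y≡x)) x∉ys)))))
  length-remove {x} {xs = y ∷ ys} (y∉ys ∷ u) (there x∈ys) =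
    cong suc (trans (length-remove u x∈ys)
                    (cong length (sym (filter-accept (x ≢?_) (λ y≡x → All.lookup y∉ys x∈ys y≡x)))))

  filter-remove : ∀ {p} {P : Pred A p} (P? : Decidable P) {x} → ¬ P x →
                  ∀ xs → filter P? (filter (x ≢?_) xs) ≡ filter P? xs
  filter-remove P? ¬Px [] = refl
  filter-remove P? {x} ¬Px (y ∷ ys) with y ≟ x
  ... | yes refl = trans (filter-remove P? ¬Px ys) (sym (filter-reject P? ¬Px))
  ... | no _ with P? y
  ...   | yes _ = cong (y ∷_) (filter-remove P? ¬Px ys)
  ...   | no _  = filter-remove P? ¬Px ys

  module _ (σ : A → A) (σ-involutive : ∀ x → σ (σ x) ≡ x) where

    fixed? : Decidable (λ x → σ x ≡ x)
    fixed? x = σ x ≟ x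

    σ-Closed : List A → Set
    σ-Closed xs = ∀ {x} → x ∈ₗ xs → σ x ∈ₗ xs

    private
      σ-injective : ∀ {x y} → σ x ≡ σ y → x ≡ y
      σ-injective {x} {y} σx≡σy = trans (sym (σ-involutive x)) (trans (cong σ σx≡σy) (σ-involutive y))

      drop-fixed : ∀ {x ys} → σ x ≡ x → All (λ y → ¬ x ≡ y) ys → σ-Closed (x ∷ ys) → σ-Closed ys
      drop-fixed {x} σx≡x x∉ys closed {y} y∈ys with closed (there y∈ys)
      ... | here σy≡x   = contradiction (sym (σ-injective (trans σy≡x (sym σx≡x)))) (All.lookup x∉ys y∈ys)
      ... | there σy∈ys = σy∈ys

      partner-∈ : ∀ {x ys} → ¬ σ x ≡ x → σ-Closed (x ∷ ys) → σ x ∈ₗ ys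
      partner-∈ σx≢x closed with closed (here refl)
      ... | here σx≡x   = contradiction σx≡x σx≢x
      ... | there σx∈ys = σx∈ys

      drop-pair : ∀ {x ys} → All (λ y → ¬ x ≡ y) ys → σ-Closed (x ∷ ys) → σ-Closed (filter (σ x ≢?_) ys)
      drop-pair {x} {ys} x∉ys closed {y} y∈ with ∈-filter⁻ (σ x ≢?_) y∈
      ... | y∈ys , y≢σx with closed (there y∈ys)
      ...   | here σy≡x   = contradiction (trans (sym (σ-involutive y)) (cong σ σy≡x)) y≢σx
      ...   | there σy∈ys = ∈-filter⁺ (σ x ≢?_) σy∈ys (λ σy≡σx → All.lookup x∉ys y∈ys (sym (σ-injective σy≡σx)))

    -- the elements outside Fix σ come in pairs {x , σ x}
    length≡pairs+fixed : ∀ {xs} → Unique xs → σ-Closed xs → ∃[ j ] (length xs ≡ j + j + length (filter fixed? xs))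
    length≡pairs+fixed {xs} = go (length xs) ≤-refl
      where
      go : ∀ n {xs} → length xs ≤ n → Unique xs → σ-Closed xs → ∃[ j ] (length xs ≡ j + j + length (filter fixed? xs))
      go _       {[]}     _        _              _      = 0 , refl
      go (suc n) {x ∷ ys} (s≤s ≤n) (x∉ys ∷ uys) closed with fixed? x
      ... | yes σx≡x =
        let (j , eq) = go n ≤n uys (drop-fixed σx≡x x∉ys closed)
        in j , trans (cong suc eq) (sym (+-suc (j + j) _))
      ... | no σx≢x =
        let σx∈ys = partner-∈ σx≢x closed
            zs = filter (σ x ≢?_) ys
            (j , eq) = go n (≤-trans (m≤n⇒m≤1+n ≤-refl) (subst (_≤ n) (length-remove uys σx∈ys) ≤n))
                          (Unique.filter⁺ (σ x ≢?_) uys) (drop-pair x∉ys closed)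
            σx-not-fixed = λ σσx≡σx → σx≢x (σ-injective σσx≡σx)
        in suc j , (begin
          suc (length ys)                                ≡⟨ cong suc (length-remove uys σx∈ys) ⟩
          suc (suc (length zs))                          ≡⟨ cong (λ n → suc (suc n)) eq ⟩
          suc (suc (j + j + length (filter fixed? zs)))
            ≡⟨ cong (λ c → suc (suc (j + j + length c))) (filter-remove fixed? σx-not-fixed ys) ⟩
          suc (suc (j + j + length (filter fixed? ys)))
            ≡⟨ cong (λ c → suc c + length (filter fixed? ys)) (sym (+-suc j j)) ⟩
          suc j + suc j + length (filter fixed? ys)      ∎)
        where open ≡-Reasoning

  length-filterᵇ-insert : ∀ {S : A → Bool} {g xs} → S g ≡ false → Unique xs → g ∈ₗ xs →
                          length (filterᵇ (λ x → S x ∨ ⌊ x ≟ g ⌋) xs) ≡ suc (length (filterᵇ S xs))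
  length-filterᵇ-insert {S} {g} {g ∷ ys} Sg≡false (g∉ys ∷ _) (here refl) with g ≟ g
  ... | no g≢g = contradiction refl g≢g
  ... | yes _ rewrite Sg≡false = cong (λ xs → suc (length xs)) (insert-absent ys g∉ys)
    where
    insert-absent : ∀ ys → All (λ y → ¬ g ≡ y) ys → filterᵇ (λ x → S x ∨ ⌊ x ≟ g ⌋) ys ≡ filterᵇ S ys
    insert-absent []       All.[]            = refl
    insert-absent (y ∷ ys) (g≢y All.∷ g∉ys) with y ≟ g
    ... | yes y≡g = contradiction (sym y≡g) g≢y
    ... | no _ with S y
    ...   | true  = cong (y ∷_) (insert-absent ys g∉ys)
    ...   | false = insert-absent ys g∉ys
  length-filterᵇ-insert {S} {g} {y ∷ ys} Sg≡false (y∉ys ∷ u) (there g∈ys) with y ≟ g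
  ... | yes refl = contradiction refl (All.lookup y∉ys g∈ys)
  ... | no _ with S y
  ...   | true  = cong suc (length-filterᵇ-insert Sg≡false u g∈ys)
  ...   | false = length-filterᵇ-insert Sg≡false u g∈ys

length-singleton : ∀ {A : Set} {x : A} {xs} → Unique xs → x ∈ₗ xs → (∀ {y} → y ∈ₗ xs → y ≡ x) → length xs ≡ 1
length-singleton {xs = _ ∷ []}     _              _ _    = refl
length-singleton {xs = y ∷ z ∷ zs} ((y≢z All.∷ _) ∷ _) _ only =
  contradiction (trans (only (here refl)) (sym (only (there (here refl))))) y≢z

pty-double+ : ∀ j r → pty (j + j + r) ≡ pty r
pty-double+ zero    r = refl
pty-double+ (suc j) r rewrite +-suc j j = pty-double+ j r

pty-suc-odd : ∀ n → pty n ≡ 1 → pty (suc n) ≡ 0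
pty-suc-odd (suc zero)    _ = refl
pty-suc-odd (suc (suc n)) p = pty-suc-odd n p

pty-suc-even : ∀ n → pty n ≡ 0 → pty (suc n) ≡ 1
pty-suc-even zero          _ = refl
pty-suc-even (suc (suc n)) p = pty-suc-even n p

pty-*-even : ∀ a b → pty a ≡ 0 → pty (a * b) ≡ 0
pty-*-even a b a-even = trans (%-distribˡ-* a b 2) (cong (λ z → (z * (b % 2)) % 2) a-even)

pty-*-odd : ∀ a b → pty a ≡ 1 → pty b ≡ 1 → pty (a * b) ≡ 1
pty-*-odd a b a-odd b-odd = trans (%-distribˡ-* a b 2) (cong₂ (λ u v → (u * v) % 2) a-odd b-odd)

pty-+-even : ∀ a b → pty a ≡ 0 → pty b ≡ 0 → pty (a + b) ≡ 0
pty-+-even a b a-even b-even = trans (%-distribˡ-+ a b 2) (cong₂ (λ u v → (u + v) % 2) a-even b-even)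

-- b − 1 stands in for the negative Bézout coefficient: −x ≡ (b − 1)·x (mod b)
inverse-mod : ∀ a b .{{_ : NonZero b}} → Coprime a b → ∃[ j ] ((j * a) % b ≡ 1 % b)
inverse-mod a b coprime with coprime-Bézout coprime
... | Bézout.+- x y eq = x , trans (cong (_% b) (sym eq)) ([m+kn]%n≡m%n 1 y b)
inverse-mod a (suc b′) coprime | Bézout.-+ x y eq = b′ * x , (begin
    (b′ * x * a) % suc b′                 ≡⟨ [m+kn]%n≡m%n (b′ * x * a) 1 (suc b′) ⟨
    (b′ * x * a + 1 * suc b′) % suc b′    ≡⟨ cong (_% suc b′) shift ⟩
    (1 + (b′ * y) * suc b′) % suc b′      ≡⟨ [m+kn]%n≡m%n 1 (b′ * y) (suc b′) ⟩
    1 % suc b′                            ∎)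
  where
  open ≡-Reasoning
  shift : b′ * x * a + 1 * suc b′ ≡ 1 + (b′ * y) * suc b′
  shift = begin
    b′ * x * a + 1 * suc b′
      ≡⟨ solve 3 (λ b′ x a → b′ :* x :* a :+ con 1 :* (con 1 :+ b′) := con 1 :+ b′ :* (con 1 :+ x :* a)) refl b′ x a ⟩
    1 + b′ * (1 + x * a)        ≡⟨ cong (λ z → 1 + b′ * z) eq ⟩
    1 + b′ * (y * suc b′)       ≡⟨ cong (1 +_) (*-assoc b′ y (suc b′)) ⟨
    1 + (b′ * y) * suc b′       ∎

module CRTSummand (n n′ j : ℕ) .{{_ : NonZero n}} .{{_ : NonZero n′}} (j-inverse : (j * n′) % n ≡ 1 % n) where

  summand : ℕ → ℕ
  summand c = suc n * (n′ * (j * c))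

  summand-%-n : ∀ c → summand c % n ≡ c % n
  summand-%-n c = begin
    (n′ * (j * c) + n * (n′ * (j * c))) % n   ≡⟨ cong (λ z → (n′ * (j * c) + z) % n) (*-comm n (n′ * (j * c))) ⟩
    (n′ * (j * c) + (n′ * (j * c)) * n) % n   ≡⟨ [m+kn]%n≡m%n (n′ * (j * c)) (n′ * (j * c)) n ⟩
    (n′ * (j * c)) % n
      ≡⟨ cong (_% n) (solve 3 (λ n′ j c → n′ :* (j :* c) := (j :* n′) :* c) refl n′ j c) ⟩
    ((j * n′) * c) % n                        ≡⟨ %-distribˡ-* (j * n′) c n ⟩
    (((j * n′) % n) * (c % n)) % n            ≡⟨ cong (λ z → (z * (c % n)) % n) j-inverse ⟩
    ((1 % n) * (c % n)) % n                   ≡⟨ %-distribˡ-* 1 c n ⟨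
    (1 * c) % n                               ≡⟨ cong (_% n) (*-identityˡ c) ⟩
    c % n                                     ∎
    where open ≡-Reasoning

  n′∣summand : ∀ c → n′ ∣ summand c
  n′∣summand c = divides (suc n * (j * c))
    (solve 4 (λ n n′ j c → (con 1 :+ n) :* (n′ :* (j :* c)) := ((con 1 :+ n) :* (j :* c)) :* n′) refl n n′ j c)

  summand-even : pty n ≡ 1 → ∀ c → pty (summand c) ≡ 0
  summand-even n-odd c = pty-*-even (suc n) (n′ * (j * c)) (pty-suc-odd n n-odd)

even-crt : ∀ m k .{{_ : NonZero m}} .{{_ : NonZero k}} → pty m ≡ 1 → pty k ≡ 1 → Coprime m k →
           ∀ c d → ∃[ t ] (pty t ≡ 0 × t % m ≡ c % m × t % k ≡ d % k)
even-crt m k m-odd k-odd coprime c d =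
  Sₘ.summand c + Sₖ.summand d
  , pty-+-even (Sₘ.summand c) (Sₖ.summand d) (Sₘ.summand-even m-odd c) (Sₖ.summand-even k-odd d)
  , trans (%-remove-+ʳ (Sₘ.summand c) (Sₖ.n′∣summand d)) (Sₘ.summand-%-n c)
  , trans (%-remove-+ˡ (Sₖ.summand d) (Sₘ.n′∣summand c)) (Sₖ.summand-%-n d)
  where
  jₘ : ∃[ j ] ((j * k) % m ≡ 1 % m)
  jₘ = inverse-mod k m (Coprimality.sym coprime)
  jₖ : ∃[ j ] ((j * m) % k ≡ 1 % k)
  jₖ = inverse-mod m k coprime
  module Sₘ = CRTSummand m k (proj₁ jₘ) (proj₂ jₘ)
  module Sₖ = CRTSummand k m (proj₁ jₖ) (proj₂ jₖ)

module ZnProperties (n : ℕ) .{{_ : NonZero n}} where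
  open Zn n

  toℕ-mod : ∀ x → toℕ (x mod n) ≡ x % n
  toℕ-mod x = toℕ-fromℕ< _

  mod-cong : ∀ {x y} → x % n ≡ y % n → x mod n ≡ y mod n
  mod-cong eq = toℕ-injective (trans (toℕ-mod _) (trans eq (sym (toℕ-mod _))))

  mod-toℕ : ∀ a → toℕ a mod n ≡ a
  mod-toℕ a = toℕ-injective (trans (toℕ-mod (toℕ a)) (m<n⇒m%n≡m (toℕ<n a)))

  %-absorbˡ : ∀ x y → (x % n + y) % n ≡ (x + y) % n
  %-absorbˡ x y = begin
    (x % n + y) % n              ≡⟨ %-distribˡ-+ (x % n) y n ⟩
    (x % n % n + y % n) % n      ≡⟨ cong (λ z → (z + y % n) % n) (m%n%n≡m%n x n) ⟩
    (x % n + y % n) % n          ≡⟨ %-distribˡ-+ x y n ⟨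
    (x + y) % n                  ∎
    where open ≡-Reasoning

  %-absorbʳ : ∀ x y → (x + y % n) % n ≡ (x + y) % n
  %-absorbʳ x y = begin
    (x + y % n) % n  ≡⟨ cong (_% n) (+-comm x (y % n)) ⟩
    (y % n + x) % n  ≡⟨ %-absorbˡ y x ⟩
    (y + x) % n      ≡⟨ cong (_% n) (+-comm y x) ⟩
    (x + y) % n      ∎
    where open ≡-Reasoning

  ⊕-assoc : ∀ a b c → (a ⊕ b) ⊕ c ≡ a ⊕ (b ⊕ c)
  ⊕-assoc a b c = mod-cong (begin
    (toℕ (a ⊕ b) + toℕ c) % n               ≡⟨ cong (λ z → (z + toℕ c) % n) (toℕ-mod _) ⟩
    ((toℕ a + toℕ b) % n + toℕ c) % n       ≡⟨ %-absorbˡ (toℕ a + toℕ b) (toℕ c) ⟩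
    (toℕ a + toℕ b + toℕ c) % n             ≡⟨ cong (_% n) (+-assoc (toℕ a) (toℕ b) (toℕ c)) ⟩
    (toℕ a + (toℕ b + toℕ c)) % n           ≡⟨ %-absorbʳ (toℕ a) (toℕ b + toℕ c) ⟨
    (toℕ a + (toℕ b + toℕ c) % n) % n       ≡⟨ cong (λ z → (toℕ a + z) % n) (toℕ-mod _) ⟨
    (toℕ a + toℕ (b ⊕ c)) % n               ∎)
    where open ≡-Reasoning

  ⊕-comm : ∀ a b → a ⊕ b ≡ b ⊕ a
  ⊕-comm a b = cong (_mod n) (+-comm (toℕ a) (toℕ b))

  ⊕-identityʳ : ∀ a → a ⊕ z0 ≡ a
  ⊕-identityʳ a = trans (mod-cong (begin
    (toℕ a + toℕ z0) % n  ≡⟨ cong (λ z → (toℕ a + z) % n) (toℕ-mod 0) ⟩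
    (toℕ a + 0 % n) % n   ≡⟨ %-absorbʳ (toℕ a) 0 ⟩
    (toℕ a + 0) % n       ≡⟨ cong (_% n) (+-identityʳ (toℕ a)) ⟩
    toℕ a % n             ∎)) (mod-toℕ a)
    where open ≡-Reasoning

  ⊕-identityˡ : ∀ a → z0 ⊕ a ≡ a
  ⊕-identityˡ a = trans (⊕-comm z0 a) (⊕-identityʳ a)

  ⊕-inverseʳ : ∀ a → a ⊕ (⊖ a) ≡ z0
  ⊕-inverseʳ a = mod-cong (begin
    (toℕ a + toℕ (⊖ a)) % n        ≡⟨ cong (λ z → (toℕ a + z) % n) (toℕ-mod _) ⟩
    (toℕ a + (n ∸ toℕ a) % n) % n  ≡⟨ %-absorbʳ (toℕ a) (n ∸ toℕ a) ⟩
    (toℕ a + (n ∸ toℕ a)) % n      ≡⟨ cong (_% n) (m+[n∸m]≡n (<⇒≤ (toℕ<n a))) ⟩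
    n % n                          ≡⟨ n%n≡0 n ⟩
    0                              ≡⟨ m*n%n≡0 0 n ⟨
    0 % n                          ∎)
    where open ≡-Reasoning

  scale : ℕ → Fin n → Fin n
  scale t a = (t * toℕ a) mod n

  scale-suc : ∀ t a → a ⊕ scale t a ≡ scale (suc t) a
  scale-suc t a = mod-cong (trans (cong (λ z → (toℕ a + z) % n) (toℕ-mod _)) (%-absorbʳ (toℕ a) (t * toℕ a)))

  scale-∣ : ∀ {t} → n ∣ t → ∀ a → scale t a ≡ z0
  scale-∣ n∣t a = mod-cong (trans (n∣m⇒m%n≡0 _ n (∣m⇒∣m*n (toℕ a) n∣t)) (sym (m*n%n≡0 0 n)))

  scale-one : ∀ t → scale t (1 mod n) ≡ t mod n
  scale-one t = mod-cong (begin
    (t * toℕ (1 mod n)) % n       ≡⟨ cong (λ z → (t * z) % n) (toℕ-mod 1) ⟩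
    (t * (1 % n)) % n             ≡⟨ %-distribˡ-* t (1 % n) n ⟩
    (t % n * (1 % n % n)) % n     ≡⟨ cong (λ z → (t % n * z) % n) (m%n%n≡m%n 1 n) ⟩
    (t % n * (1 % n)) % n         ≡⟨ %-distribˡ-* t 1 n ⟨
    (t * 1) % n                   ≡⟨ cong (_% n) (*-identityʳ t) ⟩
    t % n                         ∎)
    where open ≡-Reasoning

  -- a = n ∸ a would make n even
  ⊖-fixed⇒zero : pty n ≡ 1 → ∀ a → ⊖ a ≡ a → a ≡ z0
  ⊖-fixed⇒zero n-odd a ⊖a≡a with toℕ a in toℕa
  ... | zero  = toℕ-injective (trans toℕa (sym (trans (toℕ-mod 0) (m*n%n≡0 0 n))))
  ... | suc c = contradiction (trans (sym (pty-double+ (suc c) 0)) (trans (cong pty (sym n≡c+c)) n-odd)) λ ()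
    where
    a≤n : suc c ≤ n
    a≤n = subst (_≤ n) toℕa (<⇒≤ (toℕ<n a))
    n∸a≡a : n ∸ suc c ≡ suc c
    n∸a≡a = begin
      n ∸ suc c               ≡⟨ m<n⇒m%n≡m (∸-monoʳ-< {n} {suc c} {0} (s≤s z≤n) a≤n) ⟨
      (n ∸ suc c) % n         ≡⟨ toℕ-mod _ ⟨
      toℕ ((n ∸ suc c) mod n) ≡⟨ cong toℕ ⊖a≡a ⟩
      toℕ a                   ≡⟨ toℕa ⟩
      suc c                   ∎
      where open ≡-Reasoning
    n≡c+c : n ≡ suc c + suc c + 0
    n≡c+c = trans (sym (m+[n∸m]≡n a≤n)) (trans (cong (suc c +_) n∸a≡a) (sym (+-identityʳ _)))

module GroupProperties (m k : ℕ) .{{_ : NonZero m}} .{{_ : NonZero k}} where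
  open GEN m k
  module ℤ₂ = ZnProperties 2
  module ℤₘ = ZnProperties m
  module ℤₖ = ZnProperties k

  isAbelianGroup : IsAbelianGroup _≡_ _·_ e inv
  isAbelianGroup = record
    { isGroup = record
      { isMonoid = record
        { isSemigroup = record { isMagma = isMagma _·_ ; assoc = assoc }
        ; identity = (λ x → trans (comm e x) (identityʳ x)) , identityʳ
        }
      ; inverse = (λ x → trans (comm (inv x) x) (inverseʳ x)) , inverseʳ
      ; ⁻¹-cong = cong inv
      }
    ; comm = comm
    }
    where
    assoc : ∀ x y z → (x · y) · z ≡ x · (y · z)
    assoc (a , b , c , d) (a′ , b′ , c′ , d′) (a″ , b″ , c″ , d″) =
      cong₂ _,_ (ℤ₂.⊕-assoc a a′ a″) (cong₂ _,_ (ℤ₂.⊕-assoc b b′ b″)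
        (cong₂ _,_ (ℤₘ.⊕-assoc c c′ c″) (ℤₖ.⊕-assoc d d′ d″)))
    comm : ∀ x y → x · y ≡ y · x
    comm (a , b , c , d) (a′ , b′ , c′ , d′) =
      cong₂ _,_ (ℤ₂.⊕-comm a a′) (cong₂ _,_ (ℤ₂.⊕-comm b b′) (cong₂ _,_ (ℤₘ.⊕-comm c c′) (ℤₖ.⊕-comm d d′)))
    identityʳ : ∀ x → x · e ≡ x
    identityʳ (a , b , c , d) =
      cong₂ _,_ (ℤ₂.⊕-identityʳ a) (cong₂ _,_ (ℤ₂.⊕-identityʳ b) (cong₂ _,_ (ℤₘ.⊕-identityʳ c) (ℤₖ.⊕-identityʳ d)))
    inverseʳ : ∀ x → x · inv x ≡ e
    inverseʳ (a , b , c , d) =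
      cong₂ _,_ (ℤ₂.⊕-inverseʳ a) (cong₂ _,_ (ℤ₂.⊕-inverseʳ b) (cong₂ _,_ (ℤₘ.⊕-inverseʳ c) (ℤₖ.⊕-inverseʳ d)))

  abelianGroup : AbelianGroup 0ℓ 0ℓ
  abelianGroup = record { isAbelianGroup = isAbelianGroup }

  open AbelianGroup abelianGroup public
    using () renaming (assoc to ·-assoc; comm to ·-comm; identityˡ to ·-identityˡ; identityʳ to ·-identityʳ;
                       inverseˡ to ·-inverseˡ; inverseʳ to ·-inverseʳ)
  open AbelianGroupProperties abelianGroup public
    using (⁻¹-involutive; ⁻¹-∙-comm; ε⁻¹≈ε; identityʳ-unique; //-rightDividesˡ; //-rightDividesʳ)

  pow : ℕ → G → G
  pow zero    x = e
  pow (suc t) x = x · pow t x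

  pow-coordinates : ∀ t a b c d → pow t (a , b , c , d) ≡ (ℤ₂.scale t a , ℤ₂.scale t b , ℤₘ.scale t c , ℤₖ.scale t d)
  pow-coordinates zero    a b c d = refl
  pow-coordinates (suc t) a b c d rewrite pow-coordinates t a b c d =
    cong₂ _,_ (ℤ₂.scale-suc t a) (cong₂ _,_ (ℤ₂.scale-suc t b) (cong₂ _,_ (ℤₘ.scale-suc t c) (ℤₖ.scale-suc t d)))

  ⟨⟩-least : ∀ {P} (Q : G → Set) → Q e → (∀ {x y} → Q x → Q y → Q (x · y)) → (∀ {x} → Q x → Q (inv x)) →
             (∀ {x} → x ∈ P → Q x) → ∀ {x} → ⟨ P ⟩ x → Q x
  ⟨⟩-least Q Qe Q· Qinv P⊆Q (gen x∈P)   = P⊆Q x∈P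
  ⟨⟩-least Q Qe Q· Qinv P⊆Q unit        = Qe
  ⟨⟩-least Q Qe Q· Qinv P⊆Q (mul p q)   = Q· (⟨⟩-least Q Qe Q· Qinv P⊆Q p) (⟨⟩-least Q Qe Q· Qinv P⊆Q q)
  ⟨⟩-least Q Qe Q· Qinv P⊆Q (inverse p) = Qinv (⟨⟩-least Q Qe Q· Qinv P⊆Q p)

  ⟨⟩-⊆-subgroup : ∀ {P H} → IsSubgroup H → P ⊆ H → ∀ {x} → ⟨ P ⟩ x → x ∈ H
  ⟨⟩-⊆-subgroup {H = H} (He , H· , Hinv) P⊆H = ⟨⟩-least (_∈ H) He (H· _ _) (Hinv _) (P⊆H _)

  generates-⊆⟨⟩ : ∀ {P Q} → (∀ y → y ∈ Q → ⟨ P ⟩ y) → Generates Q → Generates P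
  generates-⊆⟨⟩ Q⊆⟨P⟩ genQ y = ⟨⟩-least ⟨ _ ⟩ unit mul inverse (Q⊆⟨P⟩ _) (genQ y)

  ⟨⟩-pow : ∀ {P x} t → ⟨ P ⟩ x → ⟨ P ⟩ (pow t x)
  ⟨⟩-pow zero    p = unit
  ⟨⟩-pow (suc t) p = mul p (⟨⟩-pow t p)

  subgroup-pow : ∀ {H x} → IsSubgroup H → x ∈ H → ∀ t → pow t x ∈ H
  subgroup-pow (He , _ , _)     x∈H zero    = He
  subgroup-pow H@(_ , H· , _) x∈H (suc t) = H· _ _ x∈H (subgroup-pow H x∈H t)

module FiniteG (m k : ℕ) .{{_ : NonZero m}} .{{_ : NonZero k}} where
  open GEN m k

  ∈-allG : ∀ y → y ∈ₗ allG
  ∈-allG (a , b , c , d) =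
    Membership.∈-cartesianProduct⁺ (Membership.∈-allFin a) (Membership.∈-cartesianProduct⁺ (Membership.∈-allFin b)
      (Membership.∈-cartesianProduct⁺ (Membership.∈-allFin c) (Membership.∈-allFin d)))

  allG-unique : Unique allG
  allG-unique = Unique.cartesianProduct⁺ (Unique.allFin⁺ 2) (Unique.cartesianProduct⁺ (Unique.allFin⁺ 2)
    (Unique.cartesianProduct⁺ (Unique.allFin⁺ m) (Unique.allFin⁺ k)))

  open Enumeration allG ∈-allG public

  card-∪ : ∀ {P g} → P g ≡ false → card (P ∪｛ g ｝) ≡ suc (card P)
  card-∪ {P} {g} Pg = length-filterᵇ-insert _≟G_ Pg allG-unique (∈-allG g)

module GenerationDecidable (m k : ℕ) .{{_ : NonZero m}} .{{_ : NonZero k}} (P : GEN.Sub m k) where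
  open GEN m k
  open GroupProperties m k
  open FiniteG m k

  StepFrom : Sub → G → Set
  StepFrom S y = ∃ λ x → x ∈ P × ((y · inv x) ∈ S ⊎ (y · x) ∈ S)

  stepFrom? : ∀ S y → Dec (StepFrom S y)
  stepFrom? S y = ∃? λ x → (P x Bool.≟ true) ×-dec ((S (y · inv x) Bool.≟ true) ⊎-dec (S (y · x) Bool.≟ true))

  extend : Sub → Sub
  extend S y = S y ∨ does (stepFrom? S y)

  extend-cong : ∀ {S S′} → (∀ y → S y ≡ S′ y) → ∀ y → extend S y ≡ extend S′ y
  extend-cong {S} {S′} S≗S′ y =
    cong₂ _∨_ (S≗S′ y) (does-⇔ (mk⇔ (stepFrom-cong S≗S′) (stepFrom-cong (sym ∘ S≗S′))) (stepFrom? S y) (stepFrom? S′ y))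
    where
    stepFrom-cong : ∀ {S S′} → (∀ y → S y ≡ S′ y) → StepFrom S y → StepFrom S′ y
    stepFrom-cong S≗S′ (x , x∈P , inj₁ s) = x , x∈P , inj₁ (trans (sym (S≗S′ _)) s)
    stepFrom-cong S≗S′ (x , x∈P , inj₂ s) = x , x∈P , inj₂ (trans (sym (S≗S′ _)) s)

  private
    extend-inflationary : ∀ S y → S y ≡ true → extend S y ≡ true
    extend-inflationary S y Sy rewrite Sy = refl

    stepFrom⇒extend : ∀ {S y} → StepFrom S y → extend S y ≡ true
    stepFrom⇒extend {S} {y} st rewrite dec-true (stepFrom? S y) st = ∨-zeroʳ (S y)

  open Enumeration.Iteration allG ∈-allG extend extend-inflationary extend-cong (λ y → does (y ≟G e))
    renaming (limit to closure; limit-closed to closure-closed)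

  extend-true : ∀ S y → extend S y ≡ true → S y ≡ true ⊎ StepFrom S y
  extend-true S y eq with S y
  ... | true  = inj₁ refl
  ... | false = inj₂ (does-true (stepFrom? S y) eq)

  iterate-sound : ∀ i {y} → iterate i y ≡ true → ⟨ P ⟩ y
  iterate-sound zero    {y} eq rewrite does-true (y ≟G e) eq = unit
  iterate-sound (suc i) {y} eq with extend-true (iterate i) y eq
  ... | inj₁ s                    = iterate-sound i s
  ... | inj₂ (x , x∈P , inj₁ s) = subst ⟨ P ⟩ (//-rightDividesˡ x y) (mul (iterate-sound i s) (gen x∈P))
  ... | inj₂ (x , x∈P , inj₂ s) = subst ⟨ P ⟩ (//-rightDividesʳ x y) (mul (iterate-sound i s) (inverse (gen x∈P)))

  closure-complete : ∀ {y} → ⟨ P ⟩ y → closure y ≡ true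
  closure-complete {y} p = subst (λ z → closure z ≡ true) (·-identityˡ y) (proj₁ (translations p e e∈closure))
    where
    _∈cl : G → Set
    z ∈cl = closure z ≡ true

    e∈iterate : ∀ i → iterate i e ≡ true
    e∈iterate zero    = dec-true (e ≟G e) refl
    e∈iterate (suc i) = extend-inflationary (iterate i) e (e∈iterate i)

    e∈closure : e ∈cl
    e∈closure = e∈iterate (suc (length allG))

    Translations : G → Set
    Translations y = ∀ z → z ∈cl → (z · y) ∈cl × (z · inv y) ∈cl

    translations : ∀ {y} → ⟨ P ⟩ y → Translations y
    translations = ⟨⟩-least Translations by-e by-· by-inv by-generator
      where
      by-e : Translations e
      by-e z z∈ = subst _∈cl (sym (·-identityʳ z)) z∈
                , subst _∈cl (sym (trans (cong (z ·_) ε⁻¹≈ε) (·-identityʳ z))) z∈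
      by-· : ∀ {x y} → Translations x → Translations y → Translations (x · y)
      by-· {x} {y} tx ty z z∈ =
          subst _∈cl (·-assoc z x y) (proj₁ (ty _ (proj₁ (tx z z∈))))
        , subst _∈cl (trans (·-assoc z (inv x) (inv y)) (cong (z ·_) (⁻¹-∙-comm x y))) (proj₂ (ty _ (proj₂ (tx z z∈))))
      by-inv : ∀ {x} → Translations x → Translations (inv x)
      by-inv {x} tx z z∈ = proj₂ (tx z z∈) , subst _∈cl (cong (z ·_) (sym (⁻¹-involutive x))) (proj₁ (tx z z∈))
      by-generator : ∀ {x} → x ∈ P → Translations x
      by-generator {x} x∈P z z∈ =
          closure-closed _ (stepFrom⇒extend {closure} {z · x} (x , x∈P , inj₁ (subst _∈cl (sym (//-rightDividesʳ x z)) z∈)))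
        , closure-closed _ (stepFrom⇒extend {closure} {z · inv x}
                                               (x , x∈P , inj₂ (subst _∈cl (sym (//-rightDividesˡ x z)) z∈)))

  ⟨_⟩? : ∀ y → Dec (⟨ P ⟩ y)
  ⟨_⟩? y with closure y in cl
  ... | true  = yes (iterate-sound (suc (length allG)) cl)
  ... | false = no λ p → contradiction (trans (sym (closure-complete p)) cl) λ ()

  generates? : Dec (Generates P)
  generates? = ∀? ⟨_⟩?

module Insertion (m k : ℕ) .{{_ : NonZero m}} .{{_ : NonZero k}} where
  open GEN m k
  open GroupProperties m k

  ∪-⊇ : ∀ {P} g {y} → y ∈ P → y ∈ (P ∪｛ g ｝)
  ∪-⊇ g y∈P rewrite y∈P = refl

  ∪-∋ : ∀ P g → g ∈ (P ∪｛ g ｝)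
  ∪-∋ P g with P g | g ≟G g
  ... | true  | _       = refl
  ... | false | yes _   = refl
  ... | false | no g≢g  = contradiction refl g≢g

  ∪-elim : ∀ {P g y} → y ∈ (P ∪｛ g ｝) → y ∈ P ⊎ y ≡ g
  ∪-elim {P} {g} {y} y∈ with P y | y ≟G g
  ... | true  | _        = inj₁ refl
  ... | false | yes y≡g  = inj₂ y≡g

  ∉-of-generating-∪ : ∀ {P g} → ¬ Generates P → Generates (P ∪｛ g ｝) → P g ≡ false
  ∉-of-generating-∪ {P} {g} ¬gen gen∪ with P g in Pg
  ... | false = refl
  ... | true  = contradiction (generates-⊆⟨⟩ ∪⊆⟨P⟩ gen∪) ¬gen
    where
    ∪⊆⟨P⟩ : ∀ y → y ∈ (P ∪｛ g ｝) → ⟨ P ⟩ y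
    ∪⊆⟨P⟩ y y∈ with ∪-elim {P} y∈
    ... | inj₁ y∈P  = gen y∈P
    ... | inj₂ refl = gen Pg

module TwoAndOddParts (m k : ℕ) .{{_ : NonZero m}} .{{_ : NonZero k}} (m-odd : pty m ≡ 1) (k-odd : pty k ≡ 1) where
  open GEN m k
  open GroupProperties m k
  open FiniteG m k
  open Insertion m k
  open Zn 2 renaming (_⊕_ to _⊕₂_)
  open Zn m renaming (z0 to 0ₘ)
  open Zn k renaming (z0 to 0ₖ)

  V : Set
  V = Fin 2 × Fin 2

  0V : V
  0V = zero , zero

  _+V_ : V → V → V
  (a , b) +V (a′ , b′) = a ⊕₂ a′ , b ⊕₂ b′

  _≟V_ : DecidableEquality V
  _≟V_ = ≡-dec Fin._≟_ Fin._≟_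

  π : G → V
  π (a , b , _ , _) = a , b

  ι : V → G
  ι (a , b) = a , b , 0ₘ , 0ₖ

  ι-+V : ∀ v w → ι v · ι w ≡ ι (v +V w)
  ι-+V v w = cong₂ _,_ refl (cong₂ _,_ refl (cong₂ _,_ (ℤₘ.⊕-identityʳ 0ₘ) (ℤₖ.⊕-identityʳ 0ₖ)))

  +V-identityˡ : ∀ w → 0V +V w ≡ w
  +V-identityˡ (a , b) = cong₂ _,_ (ℤ₂.⊕-identityˡ a) (ℤ₂.⊕-identityˡ b)

  +V-identityʳ : ∀ w → w +V 0V ≡ w
  +V-identityʳ (a , b) = cong₂ _,_ (ℤ₂.⊕-identityʳ a) (ℤ₂.⊕-identityʳ b)

  +V-self : ∀ v → v +V v ≡ 0V
  +V-self (zero , zero)         = refl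
  +V-self (zero , suc zero)     = refl
  +V-self (suc zero , zero)     = refl
  +V-self (suc zero , suc zero) = refl

  π-inv : ∀ x → π (inv x) ≡ π x
  π-inv (zero     , zero     , _) = refl
  π-inv (zero     , suc zero , _) = refl
  π-inv (suc zero , zero     , _) = refl
  π-inv (suc zero , suc zero , _) = refl

  mk-odd : pty (m * k) ≡ 1
  mk-odd = pty-*-odd m k m-odd k-odd

  scale₂-odd : ∀ t → pty t ≡ 1 → ∀ a → ℤ₂.scale t a ≡ a
  scale₂-odd t t-odd zero       = toℕ-injective (trans (ℤ₂.toℕ-mod (t * 0)) (cong (_% 2) (*-zeroʳ t)))
  scale₂-odd t t-odd (suc zero) = toℕ-injective (trans (ℤ₂.toℕ-mod (t * 1)) (trans (cong (_% 2) (*-identityʳ t)) t-odd))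

  scale₂-even : ∀ t → pty t ≡ 0 → ∀ a → ℤ₂.scale t a ≡ zero
  scale₂-even t t-even = ℤ₂.scale-∣ (m%n≡0⇒n∣m t 2 t-even)

  pow-mk : ∀ x → pow (m * k) x ≡ ι (π x)
  pow-mk (a , b , c , d) = trans (pow-coordinates (m * k) a b c d)
    (cong₂ _,_ (scale₂-odd (m * k) mk-odd a) (cong₂ _,_ (scale₂-odd (m * k) mk-odd b)
      (cong₂ _,_ (ℤₘ.scale-∣ (m∣m*n k) c) (ℤₖ.scale-∣ (n∣m*n m) d))))

  OnLine : V → V → Set
  OnLine v w = w ≡ 0V ⊎ w ≡ v

  onLine-+V : ∀ {v w w′} → OnLine v w → OnLine v w′ → OnLine v (w +V w′)
  onLine-+V {v} (inj₁ refl) w′∈ = subst (OnLine v) (sym (+V-identityˡ _)) w′∈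
  onLine-+V {v} (inj₂ refl) (inj₁ refl) = inj₂ (+V-identityʳ v)
  onLine-+V {v} (inj₂ refl) (inj₂ refl) = inj₁ (+V-self v)

  ⟨⟩-onLine : ∀ v {P} → (∀ y → y ∈ P → OnLine v (π y)) → ∀ {y} → ⟨ P ⟩ y → OnLine v (π y)
  ⟨⟩-onLine v P-on-line =
    ⟨⟩-least (λ y → OnLine v (π y)) (inj₁ refl) onLine-+V (λ {x} on → subst (OnLine v) (sym (π-inv x)) on) (P-on-line _)

  -- a line {0, v} of V misses (1,0) or (0,1)
  line-not-generating : ∀ v {P} → (∀ y → y ∈ P → OnLine v (π y)) → ¬ Generates P
  line-not-generating v P-on-line generates
    with ⟨⟩-onLine v P-on-line (generates (ι (suc zero , zero)))
       | ⟨⟩-onLine v P-on-line (generates (ι (zero , suc zero)))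
  ... | inj₁ ()   | _
  ... | inj₂ _    | inj₁ ()
  ... | inj₂ refl | inj₂ ()

  -- P ⊆ C = ker π, the subgroup of odd order
  ⊆OddPart : Sub → Set
  ⊆OddPart P = ∀ y → y ∈ P → π y ≡ 0V

  ⊆OddPart? : ∀ P → Dec (⊆OddPart P)
  ⊆OddPart? P = ∀? λ y → (P y Bool.≟ true) →-dec (π y ≟V 0V)

  ⊆OddPart-not-generating : ∀ {P} → ⊆OddPart P → ¬ Generates P
  ⊆OddPart-not-generating P⊆ = line-not-generating 0V (λ y y∈P → inj₁ (P⊆ y y∈P))

  ⊆OddPart-∪-not-generating : ∀ {P} g → ⊆OddPart P → ¬ Generates (P ∪｛ g ｝)
  ⊆OddPart-∪-not-generating {P} g P⊆ = line-not-generating (π g) on-line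
    where
    on-line : ∀ y → y ∈ (P ∪｛ g ｝) → OnLine (π g) (π y)
    on-line y y∈ with ∪-elim {P} y∈
    ... | inj₁ y∈P  = inj₁ (P⊆ y y∈P)
    ... | inj₂ refl = inj₂ refl

  complement : V → V
  complement (zero     , zero)     = suc zero , zero
  complement (zero     , suc zero) = suc zero , zero
  complement (suc zero , zero)     = zero , suc zero
  complement (suc zero , suc zero) = suc zero , zero

  V-spanned : (S : V → Set) → S 0V → (∀ {w w′} → S w → S w′ → S (w +V w′)) →
              ∀ {v} → ¬ v ≡ 0V → S v → S (complement v) → ∀ w → S w
  V-spanned S S0 S+ {zero , zero} v≢0 Sv Sc w = contradiction refl v≢0
  V-spanned S S0 S+ {zero , suc zero} _ Sv Sc (zero , zero)         = S0
  V-spanned S S0 S+ {zero , suc zero} _ Sv Sc (zero , suc zero)     = Sv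
  V-spanned S S0 S+ {zero , suc zero} _ Sv Sc (suc zero , zero)     = Sc
  V-spanned S S0 S+ {zero , suc zero} _ Sv Sc (suc zero , suc zero) = S+ Sv Sc
  V-spanned S S0 S+ {suc zero , zero} _ Sv Sc (zero , zero)         = S0
  V-spanned S S0 S+ {suc zero , zero} _ Sv Sc (zero , suc zero)     = Sc
  V-spanned S S0 S+ {suc zero , zero} _ Sv Sc (suc zero , zero)     = Sv
  V-spanned S S0 S+ {suc zero , zero} _ Sv Sc (suc zero , suc zero) = S+ Sv Sc
  V-spanned S S0 S+ {suc zero , suc zero} _ Sv Sc (zero , zero)         = S0
  V-spanned S S0 S+ {suc zero , suc zero} _ Sv Sc (zero , suc zero)     = S+ Sv Sc
  V-spanned S S0 S+ {suc zero , suc zero} _ Sv Sc (suc zero , zero)     = Sc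
  V-spanned S S0 S+ {suc zero , suc zero} _ Sv Sc (suc zero , suc zero) = Sv

  partner : G → G
  partner x = proj₁ (complement (π x)) , proj₂ (complement (π x)) , 1 mod m , 1 mod k

  partner-pow : Coprime m k → ∀ x c d → ∃[ t ] (pow t (partner x) ≡ (zero , zero , c , d))
  partner-pow coprime x c d =
    let (t , t-even , t≡c , t≡d) = even-crt m k m-odd k-odd coprime (toℕ c) (toℕ d) in
    t , trans (pow-coordinates t _ _ (1 mod m) (1 mod k))
              (cong₂ _,_ (scale₂-even t t-even _) (cong₂ _,_ (scale₂-even t t-even _)
                (cong₂ _,_ (trans (ℤₘ.scale-one t) (trans (ℤₘ.mod-cong t≡c) (ℤₘ.mod-toℕ c)))
                           (trans (ℤₖ.scale-one t) (trans (ℤₖ.mod-cong t≡d) (ℤₖ.mod-toℕ d))))))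

  generates-with-partner : Coprime m k → ∀ {Q x} → ⟨ Q ⟩ x → ¬ π x ≡ 0V → ⟨ Q ⟩ (partner x) → Generates Q
  generates-with-partner coprime {Q} {x} x∈ πx≢0 partner∈ (a , b , c , d) =
    let (t , pow≡) = partner-pow coprime x c d in
    subst ⟨ Q ⟩ split (mul (V-part (a , b)) (subst ⟨ Q ⟩ pow≡ (⟨⟩-pow t partner∈)))
    where
    V-part : ∀ w → ⟨ Q ⟩ (ι w)
    V-part = V-spanned (λ w → ⟨ Q ⟩ (ι w)) unit (λ {w} {w′} p q → subst ⟨ Q ⟩ (ι-+V w w′) (mul p q)) πx≢0
               (subst ⟨ Q ⟩ (pow-mk x) (⟨⟩-pow (m * k) x∈))
               (subst ⟨ Q ⟩ (pow-mk (partner x)) (⟨⟩-pow (m * k) partner∈))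
    split : ι (a , b) · (zero , zero , c , d) ≡ (a , b , c , d)
    split = cong₂ _,_ (ℤ₂.⊕-identityʳ a) (cong₂ _,_ (ℤ₂.⊕-identityʳ b) (cong₂ _,_ (ℤₘ.⊕-identityˡ c) (ℤₖ.⊕-identityˡ d)))

  private
    members : Sub → List G
    members S = filterᵇ S allG

    members-unique : ∀ S → Unique (members S)
    members-unique S = Unique.filter⁺ (T? ∘ S) allG-unique

    ∈-members⁻ : ∀ {S y} → y ∈ₗ members S → y ∈ S
    ∈-members⁻ {S} y∈ = Equivalence.to T-≡ (proj₂ (∈-filter⁻ (T? ∘ S) {xs = allG} y∈))

    ∈-members⁺ : ∀ {S y} → y ∈ S → y ∈ₗ members S
    ∈-members⁺ {S} {y} y∈S = ∈-filter⁺ (T? ∘ S) (∈-allG y) (Equivalence.from T-≡ y∈S)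

    card-parity : ∀ S (σ : G → G) (σ-involutive : ∀ y → σ (σ y) ≡ y) → (∀ y → y ∈ S → σ y ∈ S) →
                  pty (card S) ≡ pty (length (filter (fixed? _≟G_ σ σ-involutive) (members S)))
    card-parity S σ σ-involutive closed =
      let (j , eq) = length≡pairs+fixed _≟G_ σ σ-involutive (members-unique S)
                       (λ y∈ → ∈-members⁺ (closed _ (∈-members⁻ y∈)))
      in trans (cong pty eq) (pty-double+ j _)

  -- translation by a nonzero element of V is a fixed-point-free involution
  card-even : ∀ S {v} → ¬ v ≡ 0V → (∀ y → y ∈ S → (y · ι v) ∈ S) → pty (card S) ≡ 0
  card-even S {v} v≢0 closed = trans (card-parity S σ σ-involutive closed)
    (cong (pty ∘ length) (filter-none (fixed? _≟G_ σ σ-involutive) {members S} (All.tabulate λ {y} _ σy≡y →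
      v≢0 (cong π (identityʳ-unique y (ι v) σy≡y)))))
    where
    σ : G → G
    σ y = y · ι v
    σ-involutive : ∀ y → σ (σ y) ≡ y
    σ-involutive y = begin
      (y · ι v) · ι v   ≡⟨ ·-assoc y (ι v) (ι v) ⟩
      y · (ι v · ι v)   ≡⟨ cong (y ·_) (trans (ι-+V v v) (cong ι (+V-self v))) ⟩
      y · e             ≡⟨ ·-identityʳ y ⟩
      y                 ∎
      where open ≡-Reasoning

  -- inversion on a subset of the odd part fixes only e
  card-odd : ∀ S → e ∈ S → ⊆OddPart S → (∀ y → y ∈ S → inv y ∈ S) → pty (card S) ≡ 1
  card-odd S e∈S S⊆ closed = trans (card-parity S inv ⁻¹-involutive closed)
    (cong pty (length-singleton (Unique.filter⁺ fixed (members-unique S))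
                                (∈-filter⁺ fixed (∈-members⁺ e∈S) ε⁻¹≈ε) only-e))
    where
    fixed : Decidable (λ y → inv y ≡ y)
    fixed = fixed? _≟G_ inv ⁻¹-involutive
    only-e : ∀ {y} → y ∈ₗ filter fixed (members S) → y ≡ e
    only-e {a , b , c , d} y∈ with ∈-filter⁻ fixed y∈
    ... | y∈S , inv-y≡y with S⊆ (a , b , c , d) (∈-members⁻ {S} y∈S)
    ...   | refl = cong₂ _,_ refl (cong₂ _,_ refl (cong₂ _,_
                     (ℤₘ.⊖-fixed⇒zero m-odd c (cong (proj₁ ∘ proj₂ ∘ proj₂) inv-y≡y))
                     (ℤₖ.⊖-fixed⇒zero k-odd d (cong (proj₂ ∘ proj₂ ∘ proj₂) inv-y≡y))))

pty-0⊎1 : ∀ n → pty n ≡ 0 ⊎ pty n ≡ 1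
pty-0⊎1 zero          = inj₁ refl
pty-0⊎1 (suc zero)    = inj₂ refl
pty-0⊎1 (suc (suc n)) = pty-0⊎1 n

byParity : ℕ → ℕ → ℕ → ℕ
byParity even odd zero    = even
byParity even odd (suc _) = odd

module NimFunction (m k : ℕ) .{{_ : NonZero m}} .{{_ : NonZero k}}
                   (m-odd : pty m ≡ 1) (k-odd : pty k ≡ 1) (coprime : Coprime m k) where
  open GEN m k
  open GroupProperties m k
  open FiniteG m k
  open Insertion m k
  open TwoAndOddParts m k m-odd k-odd

  generates? : ∀ P → Dec (Generates P)
  generates? P = GenerationDecidable.generates? m k P

  HasOption : (Sub → ℕ) → Sub → ℕ → Set
  HasOption nim P j = ∃[ g ] (P g ≡ false × nim (P ∪｛ g ｝) ≡ j)

  -- Opaque: unfolding nimValue during conversion checking would run the decision procedure for generation.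
  opaque
    nimValue : Sub → ℕ
    nimValue P with generates? P | ⊆OddPart? P
    ... | yes _ | _     = 0
    ... | no _  | yes _ = byParity 1 0 (pty (card P))
    ... | no _  | no _  = byParity 1 2 (pty (card P))

    nimValue-generating : ∀ {P} → Generates P → nimValue P ≡ 0
    nimValue-generating {P} P-gen with generates? P
    ... | yes _   = refl
    ... | no ¬gen = contradiction P-gen ¬gen

    nimValue-⊆OddPart : ∀ {P} → ⊆OddPart P → nimValue P ≡ byParity 1 0 (pty (card P))
    nimValue-⊆OddPart {P} P⊆ with generates? P | ⊆OddPart? P
    ... | yes P-gen | _      = contradiction P-gen (⊆OddPart-not-generating P⊆)
    ... | no _      | yes _  = refl
    ... | no _      | no ¬P⊆ = contradiction P⊆ ¬P⊆

    nimValue-mixed : ∀ {P} → ¬ Generates P → ¬ ⊆OddPart P → nimValue P ≡ byParity 1 2 (pty (card P))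
    nimValue-mixed {P} ¬gen ¬P⊆ with generates? P | ⊆OddPart? P
    ... | yes P-gen | _      = contradiction P-gen ¬gen
    ... | no _      | yes P⊆ = contradiction P⊆ ¬P⊆
    ... | no _      | no _   = refl

  ⊆OddPart-∪ : ∀ {P g} → ⊆OddPart P → π g ≡ 0V → ⊆OddPart (P ∪｛ g ｝)
  ⊆OddPart-∪ {P} P⊆ πg≡0 y y∈ with ∪-elim {P} y∈
  ... | inj₁ y∈P  = P⊆ y y∈P
  ... | inj₂ refl = πg≡0

  ¬⊆OddPart-∪ : ∀ {P} g → ¬ ⊆OddPart P → ¬ ⊆OddPart (P ∪｛ g ｝)
  ¬⊆OddPart-∪ {P} g ¬P⊆ P∪⊆ = ¬P⊆ λ y y∈P → P∪⊆ y (∪-⊇ {P} g y∈P)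

  ¬⊆OddPart⇒witness : ∀ {P} → ¬ ⊆OddPart P → ∃ λ y → y ∈ P × ¬ π y ≡ 0V
  ¬⊆OddPart⇒witness {P} ¬P⊆ with ∃? (λ y → (P y Bool.≟ true) ×-dec ¬? (π y ≟V 0V))
  ... | yes witness = witness
  ... | no ¬∃ = contradiction (λ y y∈P → decidable-stable (π y ≟V 0V) λ πy≢0 → ¬∃ (y , y∈P , πy≢0)) ¬P⊆

  option-of-⊆OddPart : ∀ {P g p} → ⊆OddPart P → P g ≡ false → pty (suc (card P)) ≡ p →
                        nimValue (P ∪｛ g ｝) ≡ byParity 1 0 p ⊎ nimValue (P ∪｛ g ｝) ≡ byParity 1 2 p
  option-of-⊆OddPart {P} {g} P⊆ Pg refl = by-cases (⊆OddPart? (P ∪｛ g ｝))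
    where
    by-cases : Dec (⊆OddPart (P ∪｛ g ｝)) →
               nimValue (P ∪｛ g ｝) ≡ byParity 1 0 (pty (suc (card P)))
               ⊎ nimValue (P ∪｛ g ｝) ≡ byParity 1 2 (pty (suc (card P)))
    by-cases (yes P∪⊆) = inj₁ (trans (nimValue-⊆OddPart P∪⊆) (cong (byParity 1 0 ∘ pty) (card-∪ Pg)))
    by-cases (no ¬P∪⊆) = inj₂ (trans (nimValue-mixed (⊆OddPart-∪-not-generating g P⊆) ¬P∪⊆)
                                      (cong (byParity 1 2 ∘ pty) (card-∪ Pg)))

  option-of-mixed : ∀ {P g p} → ¬ ⊆OddPart P → P g ≡ false → pty (suc (card P)) ≡ p →
                    nimValue (P ∪｛ g ｝) ≡ 0 ⊎ nimValue (P ∪｛ g ｝) ≡ byParity 1 2 p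
  option-of-mixed {P} {g} ¬P⊆ Pg refl = by-cases (generates? (P ∪｛ g ｝))
    where
    by-cases : Dec (Generates (P ∪｛ g ｝)) →
               nimValue (P ∪｛ g ｝) ≡ 0 ⊎ nimValue (P ∪｛ g ｝) ≡ byParity 1 2 (pty (suc (card P)))
    by-cases (yes gen∪) = inj₁ (nimValue-generating gen∪)
    by-cases (no ¬gen∪) = inj₂ (trans (nimValue-mixed ¬gen∪ (¬⊆OddPart-∪ g ¬P⊆)) (cong (byParity 1 2 ∘ pty) (card-∪ Pg)))

  odd-part-option : ∀ {P} → ⊆OddPart P → pty (card P) ≡ 0 → ∃ λ g → P g ≡ false × π g ≡ 0V
  odd-part-option {P} P⊆ even with P e in Pe
  ... | false = e , Pe , refl
  ... | true with ∃? (λ y → (P y Bool.≟ true) ×-dec (P (inv y) Bool.≟ false))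
  ...   | yes (y , y∈P , Pinvy) = inv y , Pinvy , trans (π-inv y) (P⊆ y y∈P)
  ...   | no ¬∃ = contradiction (trans (sym even) (card-odd P Pe P⊆ inverse-closed)) λ ()
    where
    inverse-closed : ∀ y → y ∈ P → inv y ∈ P
    inverse-closed y y∈P with P (inv y) in Pinvy
    ... | true  = refl
    ... | false = contradiction (y , y∈P , Pinvy) ¬∃

  generating-option : ∀ {P} → ¬ Generates P → ¬ ⊆OddPart P → ∃ λ g → P g ≡ false × Generates (P ∪｛ g ｝)
  generating-option {P} ¬gen ¬P⊆ =
    let (y , y∈P , πy≢0) = ¬⊆OddPart⇒witness ¬P⊆
        gen∪ = generates-with-partner coprime (gen (∪-⊇ {P} (partner y) y∈P)) πy≢0 (gen (∪-∋ P (partner y)))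
    in partner y , ∉-of-generating-∪ ¬gen gen∪ , gen∪

  -- if P were closed under translation by ι (π y) ∈ ⟨P⟩, its cardinality would be even
  non-generating-option : ∀ {P} → ¬ Generates P → ¬ ⊆OddPart P → pty (card P) ≡ 1 →
                          ∃ λ g → P g ≡ false × ¬ Generates (P ∪｛ g ｝)
  non-generating-option {P} ¬gen ¬P⊆ odd
    with ¬⊆OddPart⇒witness ¬P⊆
  ... | y , y∈P , πy≢0
    with ∃? (λ z → (P z Bool.≟ true) ×-dec (P (z · ι (π y)) Bool.≟ false))
  ...   | yes (z , z∈P , Pzt) = z · ι (π y) , Pzt , λ gen∪ → ¬gen (generates-⊆⟨⟩ ∪⊆⟨P⟩ gen∪)
    where
    ∪⊆⟨P⟩ : ∀ x → x ∈ (P ∪｛ z · ι (π y) ｝) → ⟨ P ⟩ x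
    ∪⊆⟨P⟩ x x∈ with ∪-elim {P} x∈
    ... | inj₁ x∈P  = gen x∈P
    ... | inj₂ refl = mul (gen z∈P) (subst ⟨ P ⟩ (pow-mk y) (⟨⟩-pow (m * k) (gen y∈P)))
  ...   | no ¬∃ = contradiction (trans (sym odd) (card-even P πy≢0 translation-closed)) λ ()
    where
    translation-closed : ∀ z → z ∈ P → (z · ι (π y)) ∈ P
    translation-closed z z∈P with P (z · ι (π y)) in Pzt
    ... | true  = refl
    ... | false = contradiction (z , z∈P , Pzt) ¬∃

  private
    avoids : ∀ {x a b j : ℕ} → x ≡ a ⊎ x ≡ b → ¬ a ≡ j → ¬ b ≡ j → ¬ x ≡ j
    avoids (inj₁ refl) a≢j _   = a≢j
    avoids (inj₂ refl) _   b≢j = b≢j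

  mex-⊆OddPart : ∀ {P} → ⊆OddPart P → IsMex (HasOption nimValue P) (nimValue P)
  mex-⊆OddPart {P} P⊆ =
    subst (IsMex (HasOption nimValue P)) (sym (nimValue-⊆OddPart P⊆)) (by-parity (pty-0⊎1 (card P)))
    where
    by-parity : pty (card P) ≡ 0 ⊎ pty (card P) ≡ 1 → IsMex (HasOption nimValue P) (byParity 1 0 (pty (card P)))
    by-parity (inj₁ even) rewrite even = no-option-1 , λ { zero _ → option-0 ; (suc _) (s≤s ()) }
      where
      odd′ : pty (suc (card P)) ≡ 1
      odd′ = pty-suc-even (card P) even
      no-option-1 : ¬ HasOption nimValue P 1
      no-option-1 (g , Pg , value≡1) = avoids (option-of-⊆OddPart P⊆ Pg odd′) (λ ()) (λ ()) value≡1
      option-0 : HasOption nimValue P 0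
      option-0 = let (g , Pg , πg≡0) = odd-part-option P⊆ even in
        g , Pg , trans (nimValue-⊆OddPart (⊆OddPart-∪ {P} P⊆ πg≡0))
                       (trans (cong (byParity 1 0 ∘ pty) (card-∪ Pg)) (cong (byParity 1 0) odd′))
    by-parity (inj₂ odd) rewrite odd = no-option-0 , λ _ ()
      where
      no-option-0 : ¬ HasOption nimValue P 0
      no-option-0 (g , Pg , value≡0) = avoids (option-of-⊆OddPart P⊆ Pg (pty-suc-odd (card P) odd)) (λ ()) (λ ()) value≡0

  mex-mixed : ∀ {P} → ¬ Generates P → ¬ ⊆OddPart P → IsMex (HasOption nimValue P) (nimValue P)
  mex-mixed {P} ¬gen ¬P⊆ =
    subst (IsMex (HasOption nimValue P)) (sym (nimValue-mixed ¬gen ¬P⊆)) (by-parity (pty-0⊎1 (card P)))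
    where
    option-0 : HasOption nimValue P 0
    option-0 = let (g , Pg , gen∪) = generating-option ¬gen ¬P⊆ in g , Pg , nimValue-generating gen∪
    by-parity : pty (card P) ≡ 0 ⊎ pty (card P) ≡ 1 → IsMex (HasOption nimValue P) (byParity 1 2 (pty (card P)))
    by-parity (inj₁ even) rewrite even = no-option-1 , λ { zero _ → option-0 ; (suc _) (s≤s ()) }
      where
      no-option-1 : ¬ HasOption nimValue P 1
      no-option-1 (g , Pg , value≡1) = avoids (option-of-mixed ¬P⊆ Pg (pty-suc-even (card P) even)) (λ ()) (λ ()) value≡1
    by-parity (inj₂ odd) rewrite odd =
      no-option-2 , λ { zero _ → option-0 ; (suc zero) _ → option-1 ; (suc (suc _)) (s≤s (s≤s ())) }
      where
      even′ : pty (suc (card P)) ≡ 0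
      even′ = pty-suc-odd (card P) odd
      no-option-2 : ¬ HasOption nimValue P 2
      no-option-2 (g , Pg , value≡2) = avoids (option-of-mixed ¬P⊆ Pg even′) (λ ()) (λ ()) value≡2
      option-1 : HasOption nimValue P 1
      option-1 = let (g , Pg , ¬gen∪) = non-generating-option ¬gen ¬P⊆ odd in
        g , Pg , trans (nimValue-mixed ¬gen∪ (¬⊆OddPart-∪ g ¬P⊆))
                       (trans (cong (byParity 1 2 ∘ pty) (card-∪ Pg)) (cong (byParity 1 2) even′))

  nimValue-isNim : IsNim nimValue
  nimValue-isNim P = nimValue-generating , λ ¬gen → by-cases ¬gen (⊆OddPart? P)
    where
    by-cases : ¬ Generates P → Dec (⊆OddPart P) → IsMex (HasOption nimValue P) (nimValue P)
    by-cases _    (yes P⊆) = mex-⊆OddPart P⊆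
    by-cases ¬gen (no ¬P⊆) = mex-mixed ¬gen ¬P⊆

module NimUniqueness (m k : ℕ) .{{_ : NonZero m}} .{{_ : NonZero k}} where
  open GEN m k
  open FiniteG m k

  mex-unique : ∀ {S S′ : ℕ → Set} {a b} → (∀ j → S j → S′ j) → (∀ j → S′ j → S j) →
               IsMex S a → IsMex S′ b → a ≡ b
  mex-unique {a = a} {b} S⊆S′ S′⊆S (¬Sa , S<a) (¬S′b , S′<b) with <-cmp a b
  ... | tri< a<b _ _ = contradiction (S′⊆S a (S′<b a a<b)) ¬Sa
  ... | tri≈ _ a≡b _ = a≡b
  ... | tri> _ _ b<a = contradiction (S⊆S′ b (S<a b b<a)) ¬S′b

  module _ {nim nim′ : Sub → ℕ} (isNim : IsNim nim) (isNim′ : IsNim nim′) where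

    -- induction on the number d ≥ |G| − |P| of elements still missing from P
    private
      agree : ∀ d P → length allG ≤ d + card P → nim P ≡ nim′ P
      options-agree : ∀ d {P g} → length allG ≤ d + card P → P g ≡ false → nim (P ∪｛ g ｝) ≡ nim′ (P ∪｛ g ｝)

      agree d P |G|≤ with GenerationDecidable.generates? m k P
      ... | yes P-gen = trans (proj₁ (isNim P) P-gen) (sym (proj₁ (isNim′ P) P-gen))
      ... | no ¬gen = mex-unique (λ j (g , Pg , eq) → g , Pg , trans (sym (options-agree d |G|≤ Pg)) eq)
                                 (λ j (g , Pg , eq) → g , Pg , trans (options-agree d |G|≤ Pg) eq)
                                 (proj₂ (isNim P) ¬gen) (proj₂ (isNim′ P) ¬gen)

      options-agree zero {P} {g} |G|≤ Pg =
        contradiction (≤-trans (subst (_≤ length allG) (card-∪ {P} {g} Pg) (length-filter (T? ∘ (P ∪｛ g ｝)) allG)) |G|≤)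
                      (<-irrefl refl)
      options-agree (suc d) {P} {g} |G|≤ Pg =
        agree d (P ∪｛ g ｝)
          (subst (length allG ≤_) (trans (sym (+-suc d (card P))) (cong (d +_) (sym (card-∪ {P} {g} Pg)))) |G|≤)

    nim-unique : ∀ P → nim P ≡ nim′ P
    nim-unique P = agree (length allG) P (m≤m+n (length allG) (card P))

∧-true⁻ : ∀ {a b} → a ∧ b ≡ true → a ≡ true × b ≡ true
∧-true⁻ {true} b≡true = refl , b≡true

∧-true⁺ : ∀ {a b} → a ≡ true → b ≡ true → a ∧ b ≡ true
∧-true⁺ refl b≡true = b≡true

isZero : Fin 2 → Bool
isZero zero    = true
isZero (suc _) = false

module Subgroups (m k : ℕ) .{{_ : NonZero m}} .{{_ : NonZero k}} where
  open GEN m k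
  open GroupProperties m k
  open FiniteG m k
  open Zn 2 renaming (_⊕_ to _⊕₂_)

  kernel-maximal : (f : G → Fin 2) → (∀ x y → f (x · y) ≡ f x ⊕₂ f y) → (∀ x → f (inv x) ≡ f x) →
                   ∀ u → f u ≡ suc zero → IsMaximal (isZero ∘ f)
  kernel-maximal f f-· f-inv u fu≡1 = (fe≡0 , closed-· , closed-inv) , u∉ , maximal
    where
    zero-⊕ : ∀ a → isZero a ≡ true → ∀ b → a ⊕₂ b ≡ b
    zero-⊕ zero _ b = ℤ₂.⊕-identityˡ b
    fe≡0 : isZero (f e) ≡ true
    fe≡0 with f e in fe
    ... | zero = refl
    ... | suc zero =
      contradiction (trans (sym fe) (trans (cong f (sym (·-identityˡ e))) (trans (f-· e e) (cong₂ _⊕₂_ fe fe)))) λ ()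
    closed-· : ∀ x y → isZero (f x) ≡ true → isZero (f y) ≡ true → isZero (f (x · y)) ≡ true
    closed-· x y fx fy rewrite f-· x y | zero-⊕ (f x) fx (f y) = fy
    closed-inv : ∀ x → isZero (f x) ≡ true → isZero (f (inv x)) ≡ true
    closed-inv x fx rewrite f-inv x = fx
    u∉ : ¬ (full ⊆ (isZero ∘ f))
    u∉ full⊆ = contradiction (trans (sym (full⊆ u refl)) (cong isZero fu≡1)) λ ()
    maximal : ∀ K → IsSubgroup K → (isZero ∘ f) ⊆ K → (K ⊆ (isZero ∘ f)) ⊎ (full ⊆ K)
    maximal K (_ , K· , _) ker⊆K with ∀? (λ y → implies? (K y) (isZero (f y)))
    ... | yes K⊆ker = inj₁ K⊆ker
    ... | no K⊈ker with ¬∀⇒∃¬ (λ y → implies? (K y) (isZero (f y))) K⊈ker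
    ...   | y , y∉ with ¬implies y∉
    ...     | y∈K , fy≢0 = inj₂ λ z _ → everything z
      where
      everything : ∀ z → z ∈ K
      everything z with isZero (f z) in fz
      ... | true  = ker⊆K z fz
      ... | false = subst (_∈ K) (trans (sym (·-assoc y (inv y) z)) (trans (cong (_· z) (·-inverseʳ y)) (·-identityˡ z)))
                          (K· y (inv y · z) y∈K (ker⊆K (inv y · z) ker))
        where
        ker : isZero (f (inv y · z)) ≡ true
        ker rewrite f-· (inv y) z | f-inv y with f y | f z
        ... | suc zero | suc zero = refl
        ... | zero     | _        = contradiction fy≢0 λ ()
        ... | suc zero | zero     = contradiction fz λ ()

  intersection-subgroup : ∀ {Ns I} → All IsSubgroup Ns → Intersection Ns I → IsSubgroup I
  intersection-subgroup {Ns} {I} subgroups int =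
      from (All.map proj₁ subgroups)
    , (λ x y x∈ y∈ → from (All.zipWith (λ (H , x∈H , y∈H) → proj₁ (proj₂ H) x y x∈H y∈H)
                                        (subgroups , All.zip (to x∈ , to y∈))))
    , (λ x x∈ → from (All.zipWith (λ (H , x∈H) → proj₂ (proj₂ H) x x∈H) (subgroups , to x∈)))
    where
    to : ∀ {x} → x ∈ I → All (x ∈_) Ns
    to {x} = Equivalence.to (int x)
    from : ∀ {x} → All (x ∈_) Ns → x ∈ I
    from {x} = Equivalence.from (int x)

  𝓘-subgroup : ∀ {I} → In𝓘 I → IsSubgroup I
  𝓘-subgroup (_ , _ , maximals , int) = intersection-subgroup (All.map proj₁ maximals) int

  𝓘-not-generating : ∀ {I P} → In𝓘 I → P ⊆ I → ¬ Generates P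
  𝓘-not-generating I∈𝓘@(_ , _ , (M-max ∷ _) , int) P⊆I P-gen =
    proj₁ (proj₂ M-max) λ x _ → All.head (Equivalence.to (int x) (⟨⟩-⊆-subgroup (𝓘-subgroup I∈𝓘) P⊆I (P-gen x)))

module StructureClasses (m k : ℕ) .{{_ : NonZero m}} .{{_ : NonZero k}}
                        (m-odd : pty m ≡ 1) (k-odd : pty k ≡ 1) (coprime : Coprime m k) where
  open GEN m k
  open GroupProperties m k
  open TwoAndOddParts m k m-odd k-odd
  open NimFunction m k m-odd k-odd coprime
  open Subgroups m k

  kernel₁ : Sub
  kernel₁ = isZero ∘ proj₁ ∘ π

  kernel₂ : Sub
  kernel₂ = isZero ∘ proj₂ ∘ π

  kernel₁-maximal : IsMaximal kernel₁
  kernel₁-maximal = kernel-maximal (proj₁ ∘ π) (λ _ _ → refl) (cong proj₁ ∘ π-inv) (ι (suc zero , zero)) refl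

  kernel₂-maximal : IsMaximal kernel₂
  kernel₂-maximal = kernel-maximal (proj₂ ∘ π) (λ _ _ → refl) (cong proj₂ ∘ π-inv) (ι (zero , suc zero)) refl

  oddCore : Sub → Sub
  oddCore I y = I y ∧ (kernel₁ y ∧ kernel₂ y)

  oddCore-𝓘 : ∀ {I} → In𝓘 I → In𝓘 (oddCore I)
  oddCore-𝓘 {I} (M , Ns , maximals , int) =
    M , Ns ++ kernel₁ ∷ kernel₂ ∷ [] , AllProperties.++⁺ maximals (kernel₁-maximal ∷ kernel₂-maximal ∷ [])
      , λ x → mk⇔ (to x) (from x)
    where
    to : ∀ x → x ∈ oddCore I → All (x ∈_) ((M ∷ Ns) ++ kernel₁ ∷ kernel₂ ∷ [])
    to x x∈ = let (x∈I , x∈kernels) = ∧-true⁻ x∈ ; (x∈k₁ , x∈k₂) = ∧-true⁻ {kernel₁ x} x∈kernels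
              in AllProperties.++⁺ (Equivalence.to (int x) x∈I) (x∈k₁ ∷ x∈k₂ ∷ [])
    from : ∀ x → All (x ∈_) ((M ∷ Ns) ++ kernel₁ ∷ kernel₂ ∷ []) → x ∈ oddCore I
    from x x∈all with AllProperties.++⁻ (M ∷ Ns) x∈all
    ... | x∈Ms , (x∈k₁ ∷ x∈k₂ ∷ []) = ∧-true⁺ (Equivalence.from (int x) x∈Ms) (∧-true⁺ x∈k₁ x∈k₂)

  kernels⇒oddPart : ∀ y → kernel₁ y ∧ kernel₂ y ≡ true → π y ≡ 0V
  kernels⇒oddPart (zero , zero , _) _ = refl

  oddPart⇒kernels : ∀ y → π y ≡ 0V → kernel₁ y ∧ kernel₂ y ≡ true
  oddPart⇒kernels (zero , zero , _) _ = refl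

  module _ {nim : Sub → ℕ} (nim≗ : ∀ P → nim P ≡ nimValue P) where

    semiTerminal-type : ∀ I → In𝓘 I → SemiTerminal I → HasType nim I 0 1 2
    semiTerminal-type I I∈𝓘 (g , I∪g-gen) =
        card-even I πy≢0 (λ z z∈I → proj₁ (proj₂ I-subgroup) z _ z∈I
                           (subst (_∈ I) (pow-mk y) (subgroup-pow I-subgroup y∈I (m * k))))
      , (λ P P∈X even → trans (value P∈X) (cong (byParity 1 2) even))
      , (λ P P∈X odd  → trans (value P∈X) (cong (byParity 1 2) odd))
      where
      I-subgroup : IsSubgroup I
      I-subgroup = 𝓘-subgroup I∈𝓘
      I⊈ : ¬ ⊆OddPart I
      I⊈ I⊆ = ⊆OddPart-∪-not-generating g I⊆ I∪g-gen
      witness : ∃ λ y → y ∈ I × ¬ π y ≡ 0V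
      witness = ¬⊆OddPart⇒witness I⊈
      y : G
      y = proj₁ witness
      y∈I : y ∈ I
      y∈I = proj₁ (proj₂ witness)
      πy≢0 : ¬ π y ≡ 0V
      πy≢0 = proj₂ (proj₂ witness)
      -- otherwise P would lie in the smaller member oddCore I of 𝓘
      P⊈ : ∀ {P} → InX I P → ¬ ⊆OddPart P
      P⊈ (P⊆I , minimal) P⊆ = minimal
        ( oddCore I , oddCore-𝓘 I∈𝓘
        , ((λ x x∈ → proj₁ (∧-true⁻ {I x} x∈)) , λ I⊆core → πy≢0 (kernels⇒oddPart y (proj₂ (∧-true⁻ {I y} (I⊆core y y∈I)))))
        , λ x x∈P → ∧-true⁺ (P⊆I x x∈P) (oddPart⇒kernels x (P⊆ x x∈P)))
      value : ∀ {P} → InX I P → nim P ≡ byParity 1 2 (pty (card P))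
      value {P} P∈X = trans (nim≗ P) (nimValue-mixed (𝓘-not-generating I∈𝓘 (proj₁ P∈X)) (P⊈ P∈X))

    nonTerminal-type : ∀ I → In𝓘 I → NonTerminal I → HasType nim I 1 1 0
    nonTerminal-type I I∈𝓘 ¬semi =
        card-odd I (proj₁ I-subgroup) I⊆ (proj₂ (proj₂ I-subgroup))
      , (λ P P∈X even → trans (value P∈X) (cong (byParity 1 0) even))
      , (λ P P∈X odd  → trans (value P∈X) (cong (byParity 1 0) odd))
      where
      I-subgroup : IsSubgroup I
      I-subgroup = 𝓘-subgroup I∈𝓘
      I⊆ : ⊆OddPart I
      I⊆ = decidable-stable (⊆OddPart? I) λ I⊈ →
        let (g , _ , I∪g-gen) = generating-option (𝓘-not-generating I∈𝓘 (λ _ x∈I → x∈I)) I⊈ in ¬semi (g , I∪g-gen)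
      value : ∀ {P} → InX I P → nim P ≡ byParity 1 0 (pty (card P))
      value {P} (P⊆I , _) = trans (nim≗ P) (nimValue-⊆OddPart λ x x∈P → I⊆ x (P⊆I x x∈P))

  terminal-type : ∀ {nim} → IsNim nim → HasTypeG nim 0 0 0
  terminal-type isNim =
      card-even full {suc zero , zero} (λ ()) (λ _ _ → refl)
    , (λ P _ P-gen _ → proj₁ (isNim P) P-gen)
    , (λ P _ P-gen _ → proj₁ (isNim P) P-gen)

  nimValue-∅ : nimValue ∅ ≡ 1
  nimValue-∅ = trans (nimValue-⊆OddPart λ _ ())
                     (cong (byParity 1 0 ∘ pty ∘ length) (filter-none (T? ∘ ∅) {allG} (All.tabulate λ _ ())))

proposition8p14 : (m k : ℕ) .{{_ : NonZero m}} .{{_ : NonZero k}}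
    → pty m ≡ 1 → pty k ≡ 1 → Coprime m k
    → (∃[ nim ] GEN.IsNim m k nim)
    × (∀ nim → GEN.IsNim m k nim → GEN.Conclusion m k nim)
proposition8p14 m k m-odd k-odd coprime =
  (nimValue , nimValue-isNim) , λ nim isNim →
    let nim≗ = nim-unique isNim nimValue-isNim in
    terminal-type isNim , semiTerminal-type nim≗ , nonTerminal-type nim≗ , trans (nim≗ (GEN.∅ m k)) nimValue-∅
  where
  open NimFunction m k m-odd k-odd coprime
  open NimUniqueness m k
  open StructureClasses m k m-odd k-odd coprime
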